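{- There exists a positive integer $K_0$ such that for every integer $K\ge K_0$, $$\#\{n\le K:\ \sigma(30n+1)<\sigma(30n)\}\;>\;\#\{n\le K:\ \sigma(30n+1)>\sigma(30n)\},$$ where $n$ ranges over positive integers.
   Context: For a positive integer $n$, $\sigma(n)$ denotes the sum of all positive divisors of $n$. -}

module Defs where

open import Data.Nat using (ℕ; zero; suc; _+_; _*_; _<_; _<?_)
open import Data.Nat.Divisibility using (_∣_; _∣?_)
open import Data.List using (List; filter; length; map)
open import Data.Nat.ListAction using (sum)
open import Data.List.Base using (upTo)
open import Relation.Nullary.Decidable using (Dec)

range1 : ℕ → List ℕ
range1 n = map suc (upTo n)

-- σ n = sum of all positive divisors of n (σ 0 = 0; only used for n ≥ 1)
σ : ℕ → ℕ
σ n = sum (filter (λ d → d ∣? n) (range1 n))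

countLess : ℕ → ℕ
countLess K = length (filter (λ n → σ (30 * n + 1) <? σ (30 * n)) (range1 K))

countGreater : ℕ → ℕ
countGreater K = length (filter (λ n → σ (30 * n) <? σ (30 * n + 1)) (range1 K))

{-# OPTIONS --safe #-}
-- Every divisor of 30 gives a divisor of 30n, so σ(30n) ≥ σ(30) n = 72n. Hence σ(30n+1) > σ(30n) only for
-- "bad" n, those with σ(30n+1) ≥ 72n, while σ(30n+1) < σ(30n) for every other n; it suffices that fewer
-- than K/2 of the n ≤ K are bad.
--
-- Writing σ(m) = Σ_{b ∣ m} m/b and exchanging sums, Σ_{n≤K} σ(30n+1) = Σ_b Σ_{n≤K, b ∣ 30n+1} (30n+1)/b.
-- The term b = 1 is Σ (30n+1); b = 2, …, 6 contribute nothing, as 30n+1 is prime to 30; for b ≥ 7 the n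
-- with b ∣ 30n+1 are b apart, so the term is at most (30K+1)(K+b)/b². Comparing with 1/(b(b-1)), which
-- telescopes, on 7 ≤ b ≤ 1000 and 1000 < b ≤ K, and bounding each b > K by 30, the excess of
-- Σ σ(30n+1) over Σ (30n+1) is about 5.06 K². But each bad n adds about 42n to that excess, and at
-- least K/2 distinct bad n would add about 42 K²/8 = 5.25 K².
module Submission where

open import Defs
open import Data.Nat using (ℕ; _≤_; _<_)
open import Data.Product using (Σ-syntax; _×_)

open import Data.Nat using (zero; suc; _+_; _*_; _∸_; pred; z≤n; s≤s; z<s; _≤?_; _<?_; NonZero; >-nonZero)
open import Data.Nat.Properties
open import Data.Nat.Divisibility
  using (_∣_; _∣?_; divides; ∣⇒≤; *-monoˡ-∣; ∣m+n∣m⇒∣n; ∣-trans; ∣1⇒≡1; m∣m*n; 1∣_)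
open import Data.Nat.Coprimality using (Coprime; coprime?; coprime-divisor)
open import Data.Nat.ListAction using (sum)
open import Data.Nat.ListAction.Properties using (sum-++)
open import Data.Nat.Tactic.RingSolver using (solve-∀)
open import Data.List using (List; []; _∷_; [_]; _++_; map; filter; length; upTo)
open import Data.List.Properties using (upTo-∷ʳ; map-++)
open import Data.Product using (_,_; ∃-syntax)
open import Data.Sum using (_⊎_; inj₁; inj₂)
open import Data.Empty using (⊥; ⊥-elim)
open import Function using (_∘_)
open import Level using (Level)
open import Relation.Binary.PropositionalEquality
  using (_≡_; _≢_; refl; sym; trans; cong; cong₂; subst; subst₂; module ≡-Reasoning)
open import Relation.Nullary using (Dec; yes; no; ¬_; contradiction)
open import Relation.Nullary.Decidable using (from-no)
open import Relation.Unary using (Pred; Decidable)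

private
  variable
    p q : Level
    P : Set p
    A : Pred ℕ p
    Q : Pred ℕ q
    f g : ℕ → ℕ

infix 8 [_]·_

[_]·_ : Dec P → ℕ → ℕ
[ yes _ ]· x = x
[ no _ ]· _ = 0

[]·-yes : (d : Dec P) {x : ℕ} → P → [ d ]· x ≡ x
[]·-yes (yes _) _ = refl
[]·-yes (no ¬p) p = contradiction p ¬p

[]·-no : (d : Dec P) {x : ℕ} → ¬ P → [ d ]· x ≡ 0
[]·-no (yes p) ¬p = contradiction p ¬p
[]·-no (no _) _ = refl

[]·-≤ : (d : Dec P) (x : ℕ) → [ d ]· x ≤ x
[]·-≤ (yes _) x = ≤-refl
[]·-≤ (no _) x = z≤n

[]·≡*[]·1 : (d : Dec P) (x : ℕ) → [ d ]· x ≡ x * [ d ]· 1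
[]·≡*[]·1 (yes _) x = sym (*-identityʳ x)
[]·≡*[]·1 (no _) x = sym (*-zeroʳ x)

∑ : ℕ → (ℕ → ℕ) → ℕ
∑ zero f = 0
∑ (suc N) f = ∑ N f + f (suc N)

∑-cong : ∀ N → (∀ i → 1 ≤ i → i ≤ N → f i ≡ g i) → ∑ N f ≡ ∑ N g
∑-cong zero eq = refl
∑-cong (suc N) eq =
  cong₂ _+_ (∑-cong N λ i 1≤i i≤N → eq i 1≤i (m≤n⇒m≤1+n i≤N)) (eq (suc N) (s≤s z≤n) ≤-refl)

∑-mono-≤ : ∀ N → (∀ i → 1 ≤ i → i ≤ N → f i ≤ g i) → ∑ N f ≤ ∑ N g
∑-mono-≤ zero le = z≤n
∑-mono-≤ (suc N) le =
  +-mono-≤ (∑-mono-≤ N λ i 1≤i i≤N → le i 1≤i (m≤n⇒m≤1+n i≤N)) (le (suc N) (s≤s z≤n) ≤-refl)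

∑-const : ∀ N c → ∑ N (λ _ → c) ≡ N * c
∑-const zero c = refl
∑-const (suc N) c = trans (cong (_+ c) (∑-const N c)) (+-comm (N * c) c)

∑-zeros : ∀ N → (∀ i → 1 ≤ i → i ≤ N → f i ≡ 0) → ∑ N f ≡ 0
∑-zeros N vanish = trans (∑-cong N vanish) (trans (∑-const N 0) (*-zeroʳ N))

∑-distrib-+ : ∀ N (f g : ℕ → ℕ) → ∑ N (λ i → f i + g i) ≡ ∑ N f + ∑ N g
∑-distrib-+ zero f g = refl
∑-distrib-+ (suc N) f g = begin
  ∑ N (λ i → f i + g i) + (f (suc N) + g (suc N))  ≡⟨ cong (_+ (f (suc N) + g (suc N))) (∑-distrib-+ N f g) ⟩
  ∑ N f + ∑ N g + (f (suc N) + g (suc N))          ≡⟨ +-assoc-middle (∑ N f) (∑ N g) _ _ ⟩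
  ∑ N f + f (suc N) + (∑ N g + g (suc N))          ∎
  where
  open ≡-Reasoning
  +-assoc-middle : ∀ a b c d → a + b + (c + d) ≡ a + c + (b + d)
  +-assoc-middle = solve-∀

*-distribˡ-∑ : ∀ N c (f : ℕ → ℕ) → c * ∑ N f ≡ ∑ N (λ i → c * f i)
*-distribˡ-∑ zero c f = *-zeroʳ c
*-distribˡ-∑ (suc N) c f =
  trans (*-distribˡ-+ c (∑ N f) (f (suc N))) (cong (_+ c * f (suc N)) (*-distribˡ-∑ N c f))

∑-comm : ∀ N M (h : ℕ → ℕ → ℕ) → ∑ N (λ i → ∑ M (h i)) ≡ ∑ M (λ j → ∑ N (λ i → h i j))
∑-comm zero M h = sym (∑-zeros M λ _ _ _ → refl)
∑-comm (suc N) M h = trans (cong (_+ ∑ M (h (suc N))) (∑-comm N M h)) (sym (∑-distrib-+ M _ (h (suc N))))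

∑-split : ∀ a k (f : ℕ → ℕ) → ∑ (a + k) f ≡ ∑ a f + ∑ k (λ i → f (a + i))
∑-split a zero f = trans (cong (λ n → ∑ n f) (+-identityʳ a)) (sym (+-identityʳ (∑ a f)))
∑-split a (suc k) f rewrite +-suc a k =
  trans (cong (_+ f (suc (a + k))) (∑-split a k f)) (+-assoc (∑ a f) _ _)

∑-extend : ∀ {m N} {f : ℕ → ℕ} → m ≤ N → (∀ i → m < i → f i ≡ 0) → ∑ N f ≡ ∑ m f
∑-extend {m} {N} {f} m≤N vanish = begin
  ∑ N f                                  ≡⟨ cong (λ n → ∑ n f) (sym (m+[n∸m]≡n m≤N)) ⟩
  ∑ (m + (N ∸ m)) f                      ≡⟨ ∑-split m (N ∸ m) f ⟩
  ∑ m f + ∑ (N ∸ m) (λ i → f (m + i))    ≡⟨ cong (∑ m f +_) (∑-zeros (N ∸ m) λ i 1≤i _ → vanish (m + i) (m<m+n m 1≤i)) ⟩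
  ∑ m f + 0                              ≡⟨ +-identityʳ _ ⟩
  ∑ m f                                  ∎
  where open ≡-Reasoning

∑-unique : ∀ N j {f : ℕ → ℕ} → 1 ≤ j → j ≤ N → (∀ i → i ≢ j → f i ≡ 0) → ∑ N f ≡ f j
∑-unique zero (suc _) _ () _
∑-unique (suc N) j {f} 1≤j j≤N other with suc N ≟ j
... | yes refl = cong (_+ f (suc N)) (∑-zeros N λ i _ i≤N → other i (<⇒≢ (s≤s i≤N)))
... | no N+1≢j = trans (cong₂ _+_ (∑-unique N j 1≤j j≤N-1 other) (other (suc N) N+1≢j)) (+-identityʳ _)
  where
  j≤N-1 : j ≤ N
  j≤N-1 = ≤-pred (≤∧≢⇒< j≤N (N+1≢j ∘ sym))

sum-map-range1 : ∀ N (f : ℕ → ℕ) → sum (map f (range1 N)) ≡ ∑ N f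
sum-map-range1 zero f = refl
sum-map-range1 (suc N) f = begin
  sum (map f (map suc (upTo (suc N))))        ≡⟨ cong (λ ns → sum (map f (map suc ns))) (sym (upTo-∷ʳ N)) ⟩
  sum (map f (map suc (upTo N ++ [ N ])))     ≡⟨ cong (λ ns → sum (map f ns)) (map-++ suc (upTo N) [ N ]) ⟩
  sum (map f (range1 N ++ [ suc N ]))         ≡⟨ cong sum (map-++ f (range1 N) [ suc N ]) ⟩
  sum (map f (range1 N) ++ [ f (suc N) ])     ≡⟨ sum-++ (map f (range1 N)) [ f (suc N) ] ⟩
  sum (map f (range1 N)) + (f (suc N) + 0)    ≡⟨ cong₂ _+_ (sum-map-range1 N f) (+-identityʳ _) ⟩
  ∑ N f + f (suc N)                           ∎
  where open ≡-Reasoning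

sum-filter : (A? : Decidable A) (ns : List ℕ) → sum (filter A? ns) ≡ sum (map (λ n → [ A? n ]· n) ns)
sum-filter A? [] = refl
sum-filter A? (n ∷ ns) with A? n
... | yes _ = cong (n +_) (sum-filter A? ns)
... | no _ = sum-filter A? ns

length-filter : (A? : Decidable A) (ns : List ℕ) → length (filter A? ns) ≡ sum (map (λ n → [ A? n ]· 1) ns)
length-filter A? [] = refl
length-filter A? (n ∷ ns) with A? n
... | yes _ = cong suc (length-filter A? ns)
... | no _ = length-filter A? ns

σ≡∑ : ∀ m → σ m ≡ ∑ m (λ d → [ d ∣? m ]· d)
σ≡∑ m = trans (sum-filter (_∣? m) (range1 m)) (sum-map-range1 m _)

count : Decidable A → ℕ → ℕ
count A? N = ∑ N (λ i → [ A? i ]· 1)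

length-filter-range1 : (A? : Decidable A) (N : ℕ) → length (filter A? (range1 N)) ≡ count A? N
length-filter-range1 A? N = trans (length-filter A? (range1 N)) (sum-map-range1 N _)

count-≤ : (A? : Decidable A) (N : ℕ) → count A? N ≤ N
count-≤ A? N =
  ≤-trans (∑-mono-≤ N λ i _ _ → []·-≤ (A? i) 1) (≤-reflexive (trans (∑-const N 1) (*-identityʳ N)))

count-mono : (A? : Decidable A) (B? : Decidable Q) → (∀ {i} → A i → Q i) → ∀ N → count A? N ≤ count B? N
count-mono A? B? A⇒B N = ∑-mono-≤ N λ i _ _ → pointwise i
  where
  pointwise : ∀ i → [ A? i ]· 1 ≤ [ B? i ]· 1
  pointwise i with A? i
  ... | yes Ai = ≤-reflexive (sym ([]·-yes (B? i) (A⇒B Ai)))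
  ... | no _ = z≤n

count-cover : (A? : Decidable A) (B? : Decidable Q) → (∀ {i} → ¬ Q i → A i) → ∀ N → N ≤ count A? N + count B? N
count-cover A? B? cover N = begin
  N                                         ≡⟨ sym (trans (∑-const N 1) (*-identityʳ N)) ⟩
  ∑ N (λ _ → 1)                             ≤⟨ ∑-mono-≤ N (λ i _ _ → pointwise i) ⟩
  ∑ N (λ i → [ A? i ]· 1 + [ B? i ]· 1)     ≡⟨ ∑-distrib-+ N _ _ ⟩
  count A? N + count B? N                   ∎
  where
  open ≤-Reasoning
  pointwise : ∀ i → 1 ≤ [ A? i ]· 1 + [ B? i ]· 1
  pointwise i with B? i
  ... | yes _ = m≤n+m 1 _
  ... | no ¬Bi = ≤-trans (≤-reflexive (sym ([]·-yes (A? i) (cover ¬Bi)))) (m≤m+n _ 0)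

count-triangular : (A? : Decidable A) → ∀ N → count A? N * suc (count A? N) ≤ 2 * ∑ N (λ i → [ A? i ]· i)
count-triangular A? zero = z≤n
count-triangular A? (suc N) with A? (suc N)
... | no _ = subst₂ (λ c s → c * suc c ≤ 2 * s)
  (sym (+-identityʳ (count A? N))) (sym (+-identityʳ (∑ N (λ i → [ A? i ]· i)))) (count-triangular A? N)
... | yes _ = begin
  (c + 1) * suc (c + 1)      ≡⟨ expand c ⟩
  c * suc c + 2 * (c + 1)    ≤⟨ +-mono-≤ (count-triangular A? N) (*-monoʳ-≤ 2 (+-monoˡ-≤ 1 (count-≤ A? N))) ⟩
  2 * s + 2 * (N + 1)        ≡⟨ collect s N ⟩
  2 * (s + suc N)            ∎
  where
  open ≤-Reasoning
  c s : ℕ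
  c = count A? N
  s = ∑ N (λ i → [ A? i ]· i)
  expand : ∀ c → (c + 1) * suc (c + 1) ≡ c * suc c + 2 * (c + 1)
  expand = solve-∀
  collect : ∀ s N → 2 * s + 2 * (N + 1) ≡ 2 * (s + suc N)
  collect = solve-∀

module _ {A : Pred ℕ p} (A? : Decidable A) {d : ℕ} (spaced : ∀ {i j} → i < j → A i → A j → i + d ≤ j) where

  private
    -- L is the last element of A in [1, N].
    count-spaced-last : ∀ N → count A? N ≡ 0 ⊎ ∃[ L ] (L ≤ N × A L × d * count A? N + 1 ≤ L + d)
    count-spaced-last zero = inj₁ refl
    count-spaced-last (suc N) with A? (suc N) | count-spaced-last N
    ... | no _ | inj₁ c≡0 = inj₁ (trans (+-identityʳ _) c≡0)
    ... | no _ | inj₂ (L , L≤N , AL , bound) =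
      inj₂ (L , m≤n⇒m≤1+n L≤N , AL , subst (λ c → d * c + 1 ≤ L + d) (sym (+-identityʳ _)) bound)
    ... | yes AN | inj₁ c≡0 = inj₂ (suc N , ≤-refl , AN , first)
      where
      first : d * (count A? N + 1) + 1 ≤ suc N + d
      first rewrite c≡0 | *-identityʳ d = ≤-trans (≤-reflexive (+-comm d 1)) (s≤s (m≤n+m d N))
    ... | yes AN | inj₂ (L , L≤N , AL , bound) = inj₂ (suc N , ≤-refl , AN , next)
      where
      open ≤-Reasoning
      rearrange : ∀ d c → d * (c + 1) + 1 ≡ d * c + 1 + d
      rearrange = solve-∀
      next : d * (count A? N + 1) + 1 ≤ suc N + d
      next = begin
        d * (count A? N + 1) + 1  ≡⟨ rearrange d (count A? N) ⟩
        d * count A? N + 1 + d    ≤⟨ +-monoˡ-≤ d bound ⟩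
        L + d + d                 ≤⟨ +-monoˡ-≤ d (spaced (s≤s L≤N) AL AN) ⟩
        suc N + d                 ∎

  count-spaced : 1 ≤ d → ∀ N → d * count A? N + 1 ≤ N + d
  count-spaced 1≤d N with count-spaced-last N
  ... | inj₁ c≡0 rewrite c≡0 | *-zeroʳ d = ≤-trans 1≤d (m≤n+m d N)
  ... | inj₂ (L , L≤N , _ , bound) = ≤-trans bound (+-monoˡ-≤ d L≤N)

-- cofactor m b is m / b when b ∣ m and 0 otherwise (cofactor-*). Summing over the pairs a * b ≡ m turns
-- the reindexing d ↦ m / d of the divisors of m into an interchange of summation (σ≡∑cofactor).
cofactor : ℕ → ℕ → ℕ
cofactor m b = ∑ m (λ a → [ a * b ≟ m ]· a)

∑-row : ∀ {a m} → 1 ≤ a → a ≤ m → ∑ m (λ b → [ a * b ≟ m ]· a) ≡ [ a ∣? m ]· a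
∑-row {a} {m} 1≤a a≤m with a ∣? m
... | no a∤m = ∑-zeros m λ b _ _ → []·-no (a * b ≟ m) λ ab≡m → a∤m (divides b (trans (sym ab≡m) (*-comm a b)))
... | yes (divides zero m≡0) = contradiction (subst (a ≤_) m≡0 a≤m) (<⇒≱ 1≤a)
... | yes (divides q@(suc _) m≡qa) = trans (∑-unique m q (s≤s z≤n) q≤m other) ([]·-yes (a * q ≟ m) (sym m≡aq))
  where
  instance
    a≢0 : NonZero a
    a≢0 = >-nonZero 1≤a
  m≡aq : m ≡ a * q
  m≡aq = trans m≡qa (*-comm q a)
  q≤m : q ≤ m
  q≤m = ≤-trans (m≤n*m q a) (≤-reflexive (sym m≡aq))
  other : ∀ b → b ≢ q → [ a * b ≟ m ]· a ≡ 0
  other b b≢q = []·-no (a * b ≟ m) λ ab≡m → b≢q (*-cancelˡ-≡ b q a (trans ab≡m m≡aq))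

cofactor-* : ∀ m {b} → 1 ≤ b → cofactor m b * b ≡ [ b ∣? m ]· m
cofactor-* m {b} 1≤b with b ∣? m
... | no b∤m = cong (_* b) (∑-zeros m λ a _ _ → []·-no (a * b ≟ m) λ ab≡m → b∤m (divides a (sym ab≡m)))
... | yes (divides zero refl) = refl
... | yes (divides q@(suc _) m≡qb) =
  trans (cong (_* b) (trans (∑-unique m q (s≤s z≤n) q≤m other) ([]·-yes (q * b ≟ m) (sym m≡qb)))) (sym m≡qb)
  where
  instance
    b≢0 : NonZero b
    b≢0 = >-nonZero 1≤b
  q≤m : q ≤ m
  q≤m = ≤-trans (m≤m*n q b) (≤-reflexive (sym m≡qb))
  other : ∀ a → a ≢ q → [ a * b ≟ m ]· a ≡ 0
  other a a≢q = []·-no (a * b ≟ m) λ ab≡m → a≢q (*-cancelʳ-≡ a q b (trans ab≡m m≡qb))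

cofactor-vanishes : ∀ {m b} → m < b → cofactor m b ≡ 0
cofactor-vanishes {m} {b} m<b = ∑-zeros m λ a 1≤a _ → []·-no (a * b ≟ m) λ ab≡m →
  <⇒≱ m<b (≤-trans (m≤n*m b a {{>-nonZero 1≤a}}) (≤-reflexive ab≡m))

σ≡∑cofactor : ∀ {m N} → m ≤ N → σ m ≡ ∑ N (cofactor m)
σ≡∑cofactor {m} {N} m≤N = begin
  σ m                                        ≡⟨ σ≡∑ m ⟩
  ∑ m (λ a → [ a ∣? m ]· a)                  ≡⟨ ∑-cong m (λ a 1≤a a≤m → sym (∑-row 1≤a a≤m)) ⟩
  ∑ m (λ a → ∑ m (λ b → [ a * b ≟ m ]· a))   ≡⟨ ∑-comm m m _ ⟩
  ∑ m (cofactor m)                           ≡⟨ sym (∑-extend m≤N λ _ → cofactor-vanishes) ⟩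
  ∑ N (cofactor m)                           ∎
  where open ≡-Reasoning

∑-multiples : ∀ k n (f : ℕ → ℕ) → ∑ k (λ e → f (e * suc n)) ≤ ∑ (k * suc n) f
∑-multiples zero n f = z≤n
∑-multiples (suc k) n f = begin
  ∑ k (λ e → f (e * suc n)) + f (suc k * suc n)   ≤⟨ +-monoˡ-≤ _ (∑-multiples k n f) ⟩
  ∑ a f + f (suc k * suc n)                       ≡⟨ cong (λ j → ∑ a f + f j) (+-comm (suc n) a) ⟩
  ∑ a f + f (a + suc n)                           ≤⟨ +-monoʳ-≤ (∑ a f) (m≤n+m _ _) ⟩
  ∑ a f + ∑ (suc n) (λ i → f (a + i))             ≡⟨ sym (∑-split a (suc n) f) ⟩
  ∑ (a + suc n) f                                 ≡⟨ cong (λ j → ∑ j f) (+-comm a (suc n)) ⟩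
  ∑ (suc k * suc n) f                             ∎
  where
  open ≤-Reasoning
  a = k * suc n

σ[k]*n≤σ[k*n] : ∀ k n → σ k * n ≤ σ (k * n)
σ[k]*n≤σ[k*n] k zero = subst (_≤ σ (k * 0)) (sym (*-zeroʳ (σ k))) z≤n
σ[k]*n≤σ[k*n] k n@(suc n-1) = begin
  σ k * n                                       ≡⟨ cong (_* n) (σ≡∑ k) ⟩
  ∑ k (λ e → [ e ∣? k ]· e) * n                 ≡⟨ *-comm _ n ⟩
  n * ∑ k (λ e → [ e ∣? k ]· e)                 ≡⟨ *-distribˡ-∑ k n _ ⟩
  ∑ k (λ e → n * [ e ∣? k ]· e)                 ≤⟨ ∑-mono-≤ k (λ e _ _ → multiple e) ⟩
  ∑ k (λ e → [ e * n ∣? k * n ]· (e * n))       ≤⟨ ∑-multiples k n-1 _ ⟩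
  ∑ (k * n) (λ d → [ d ∣? k * n ]· d)           ≡⟨ sym (σ≡∑ (k * n)) ⟩
  σ (k * n)                                     ∎
  where
  open ≤-Reasoning
  multiple : ∀ e → n * [ e ∣? k ]· e ≤ [ e * n ∣? k * n ]· (e * n)
  multiple e with e ∣? k
  ... | yes e∣k = ≤-reflexive (trans (*-comm n e) (sym ([]·-yes (e * n ∣? k * n) (*-monoˡ-∣ n e∣k))))
  ... | no _ = ≤-trans (≤-reflexive (*-zeroʳ n)) z≤n

-- σ 30 evaluates to 72.
σ[30n]≥72n : ∀ n → 72 * n ≤ σ (30 * n)
σ[30n]≥72n = σ[k]*n≤σ[k*n] 30

n≤σ[n] : ∀ n → n ≤ σ n
n≤σ[n] n = subst₂ _≤_ (*-identityˡ n) (cong σ (*-identityˡ n)) (σ[k]*n≤σ[k*n] 1 n)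

∣k*n+1⇒coprime : ∀ {d} k n → d ∣ k * n + 1 → Coprime d k
∣k*n+1⇒coprime k n d∣kn+1 (c∣d , c∣k) =
  ∣1⇒≡1 (∣m+n∣m⇒∣n (∣-trans c∣d d∣kn+1) (∣-trans c∣k (m∣m*n n)))

∣k*n+1-spaced : ∀ {d} k {i j} → i < j → d ∣ k * i + 1 → d ∣ k * j + 1 → i + d ≤ j
∣k*n+1-spaced {d} k {i} i<j d∣ki+1 d∣kj+1 with m≤n⇒∃[o]m+o≡n i<j
... | t , refl = ≤-trans (+-monoʳ-≤ i (∣⇒≤ d∣t+1)) (≤-reflexive (+-suc i t))
  where
  step : ∀ k i t → k * (suc i + t) + 1 ≡ k * i + 1 + k * suc t
  step = solve-∀
  d∣t+1 : d ∣ suc t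
  d∣t+1 = coprime-divisor (∣k*n+1⇒coprime k i d∣ki+1)
    (∣m+n∣m⇒∣n (subst (d ∣_) (step k i t) d∣kj+1) d∣ki+1)

2≤d≤6⇒¬coprime[d,30] : ∀ {d} → 2 ≤ d → d ≤ 6 → ¬ Coprime d 30
2≤d≤6⇒¬coprime[d,30] {1} (s≤s ()) _
2≤d≤6⇒¬coprime[d,30] {2} _ _ = from-no (coprime? 2 30)
2≤d≤6⇒¬coprime[d,30] {3} _ _ = from-no (coprime? 3 30)
2≤d≤6⇒¬coprime[d,30] {4} _ _ = from-no (coprime? 4 30)
2≤d≤6⇒¬coprime[d,30] {5} _ _ = from-no (coprime? 5 30)
2≤d≤6⇒¬coprime[d,30] {6} _ _ = from-no (coprime? 6 30)
2≤d≤6⇒¬coprime[d,30] {suc (suc (suc (suc (suc (suc (suc _))))))} _ (s≤s (s≤s (s≤s (s≤s (s≤s (s≤s ()))))))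

-- Σ_{a<b≤a+k} P / (b (b - 1)) ≤ P / a with denominators cleared; the sum telescopes.
telescoping : ∀ {a} k (y : ℕ → ℕ) {P} → 1 ≤ a → (∀ b → a < b → b ≤ a + k → y b * (b * pred b) ≤ P) →
              a * ∑ k (λ i → y (a + i)) ≤ P
telescoping {a} k y {P} 1≤a bound = *-cancelˡ-≤ (a + k) {{a+≢0 k}} (begin
  (a + k) * (a * ∑ k Y)   ≡⟨ reorder (a + k) a (∑ k Y) ⟩
  a * (a + k) * ∑ k Y     ≤⟨ partial k bound ⟩
  P * k                   ≤⟨ *-monoʳ-≤ P (m≤n+m k a) ⟩
  P * (a + k)             ≡⟨ *-comm P (a + k) ⟩
  (a + k) * P             ∎)
  where
  open ≤-Reasoning
  Y : ℕ → ℕ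
  Y i = y (a + i)
  a+≢0 : ∀ k → NonZero (a + k)
  a+≢0 k = >-nonZero (≤-trans 1≤a (m≤m+n a k))
  reorder : ∀ b a s → b * (a * s) ≡ a * b * s
  reorder = solve-∀
  expand : ∀ a k s v → (a + k) * (a * (a + suc k) * (s + v))
                       ≡ (a + suc k) * (a * (a + k) * s) + a * (v * ((a + suc k) * (a + k)))
  expand = solve-∀
  collect : ∀ a k P → (a + suc k) * (P * k) + a * P ≡ (a + k) * (P * suc k)
  collect = solve-∀
  partial : ∀ k → (∀ b → a < b → b ≤ a + k → y b * (b * pred b) ≤ P) → a * (a + k) * ∑ k Y ≤ P * k
  partial zero _ = ≤-reflexive (trans (*-zeroʳ (a * (a + 0))) (sym (*-zeroʳ P)))
  partial (suc k) bound = *-cancelˡ-≤ (a + k) {{a+≢0 k}} (begin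
    (a + k) * (a * (a + suc k) * (∑ k Y + Y (suc k)))                   ≡⟨ expand a k (∑ k Y) (Y (suc k)) ⟩
    (a + suc k) * (a * (a + k) * ∑ k Y) + a * (Y (suc k) * ((a + suc k) * (a + k)))
      ≤⟨ +-mono-≤ (*-monoʳ-≤ (a + suc k) (partial k λ b a<b b≤a+k → bound b a<b (≤-trans b≤a+k a+k≤a+suc-k)))
                  (*-monoʳ-≤ a last) ⟩
    (a + suc k) * (P * k) + a * P                                       ≡⟨ collect a k P ⟩
    (a + k) * (P * suc k)                                               ∎)
    where
    a+k≤a+suc-k : a + k ≤ a + suc k
    a+k≤a+suc-k = +-monoʳ-≤ a (n≤1+n k)
    last : Y (suc k) * ((a + suc k) * (a + k)) ≤ P
    last = subst (λ c → Y (suc k) * ((a + suc k) * pred c) ≤ P) (+-suc a k) (bound (a + suc k) (m<m+n a z<s) ≤-refl)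

quadratic-contradiction : ∀ {K s e} → 40000 ≤ K → K * (K + 2) ≤ 8 * s → 42 * s ≤ K + e →
  6000 * e ≤ 1000 * ((30 * K + 1) * (K + 1000)) + 6 * ((30 * K + 1) * (K + K)) + 6000 * ((29 * K + 1) * 30) → ⊥
quadratic-contradiction {K} {s} {e} 40000≤K square mean excess = <⇒≱ rhs<lhs lhs≤rhs
  where
  open ≤-Reasoning
  rhs : ℕ → ℕ
  rhs K = 6000 * K + (1000 * ((30 * K + 1) * (K + 1000)) + 6 * ((30 * K + 1) * (K + K)) + 6000 * ((29 * K + 1) * 30))
  lhs≤rhs : 31500 * (K * (K + 2)) ≤ rhs K
  lhs≤rhs = begin
    31500 * (K * (K + 2))  ≤⟨ *-monoʳ-≤ 31500 square ⟩
    31500 * (8 * s)        ≡⟨ trans (sym (*-assoc 31500 8 s)) (*-assoc 6000 42 s) ⟩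
    6000 * (42 * s)        ≤⟨ *-monoʳ-≤ 6000 mean ⟩
    6000 * (K + e)         ≡⟨ *-distribˡ-+ 6000 K e ⟩
    6000 * K + 6000 * e    ≤⟨ +-monoʳ-≤ (6000 * K) excess ⟩
    rhs K                  ∎
  -- Expanded in t = K - 40000, the gap between the two sides has positive coefficients.
  slack : ∀ t → let K = t + 40000 in
    31500 * (K * (K + 2)) ≡
    suc (6000 * K + (1000 * ((30 * K + 1) * (K + 1000)) + 6 * ((30 * K + 1) * (K + K)) + 6000 * ((29 * K + 1) * 30))
         + (1140 * (t * t) + 56035988 * t + 417438339999))
  slack = solve-∀
  rhs<lhs : rhs K < 31500 * (K * (K + 2))
  rhs<lhs = let t , 40000+t≡K = m≤n⇒∃[o]m+o≡n 40000≤K in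
    subst (λ K → rhs K < 31500 * (K * (K + 2))) (trans (+-comm t 40000) 40000+t≡K)
      (≤-trans (s≤s (m≤m+n _ _)) (≤-reflexive (sym (slack t))))

30n+1 : ℕ → ℕ
30n+1 n = 30 * n + 1

bad? : Decidable (λ n → 72 * n ≤ σ (30n+1 n))
bad? n = 72 * n ≤? σ (30n+1 n)

module Progression (K : ℕ) where

  D : ℕ
  D = 30n+1 K

  divisorCount : ℕ → ℕ
  divisorCount b = count (λ n → b ∣? 30n+1 n) K

  cofactorTotal : ℕ → ℕ
  cofactorTotal b = ∑ K (λ n → cofactor (30n+1 n) b)

  30n+1≤D : ∀ {n} → n ≤ K → 30n+1 n ≤ D
  30n+1≤D n≤K = +-monoˡ-≤ 1 (*-monoʳ-≤ 30 n≤K)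

  ∑σ≡∑cofactorTotal : ∑ K (λ n → σ (30n+1 n)) ≡ ∑ D cofactorTotal
  ∑σ≡∑cofactorTotal = trans (∑-cong K λ n _ n≤K → σ≡∑cofactor (30n+1≤D n≤K)) (∑-comm K D _)

  cofactorTotal-1 : cofactorTotal 1 ≡ ∑ K 30n+1
  cofactorTotal-1 = ∑-cong K λ n _ _ →
    trans (sym (*-identityʳ _)) (trans (cofactor-* (30n+1 n) ≤-refl) ([]·-yes (1 ∣? 30n+1 n) (1∣ 30n+1 n)))

  cofactorTotal-2…6 : ∀ {b} → 2 ≤ b → b ≤ 6 → cofactorTotal b ≡ 0
  cofactorTotal-2…6 {b} 2≤b b≤6 = ∑-zeros K λ n _ _ → m*n≡0⇒m≡0 _ b {{>-nonZero 1≤b}}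
    (trans (cofactor-* (30n+1 n) 1≤b)
           ([]·-no (b ∣? 30n+1 n) λ b∣ → 2≤d≤6⇒¬coprime[d,30] 2≤b b≤6 (∣k*n+1⇒coprime 30 n b∣)))
    where
    1≤b : 1 ≤ b
    1≤b = ≤-trans (s≤s z≤n) 2≤b

  cofactorTotal*b≤ : ∀ {b} → 1 ≤ b → cofactorTotal b * b ≤ D * divisorCount b
  cofactorTotal*b≤ {b} 1≤b = begin
    cofactorTotal b * b                        ≡⟨ *-comm _ b ⟩
    b * cofactorTotal b                        ≡⟨ *-distribˡ-∑ K b _ ⟩
    ∑ K (λ n → b * cofactor (30n+1 n) b)       ≡⟨ ∑-cong K (λ n _ _ → trans (*-comm b _) (cofactor-* (30n+1 n) 1≤b)) ⟩
    ∑ K (λ n → [ b ∣? 30n+1 n ]· 30n+1 n)      ≤⟨ ∑-mono-≤ K (λ n _ n≤K → atMostD n≤K) ⟩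
    ∑ K (λ n → D * [ b ∣? 30n+1 n ]· 1)        ≡⟨ *-distribˡ-∑ K D _ ⟨
    D * divisorCount b                         ∎
    where
    open ≤-Reasoning
    atMostD : ∀ {n} → n ≤ K → [ b ∣? 30n+1 n ]· 30n+1 n ≤ D * [ b ∣? 30n+1 n ]· 1
    atMostD {n} n≤K = ≤-trans (≤-reflexive ([]·≡*[]·1 (b ∣? 30n+1 n) _)) (*-monoˡ-≤ _ (30n+1≤D n≤K))

  divisorCount-spaced : ∀ {b} → 1 ≤ b → b * divisorCount b + 1 ≤ K + b
  divisorCount-spaced {b} 1≤b = count-spaced (λ n → b ∣? 30n+1 n) (∣k*n+1-spaced 30) 1≤b K

  cofactorTotal*b²≤ : ∀ {b} → 1 ≤ b → cofactorTotal b * (b * b) ≤ D * (K + b)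
  cofactorTotal*b²≤ {b} 1≤b = begin
    cofactorTotal b * (b * b)      ≡⟨ *-assoc (cofactorTotal b) b b ⟨
    cofactorTotal b * b * b        ≤⟨ *-monoˡ-≤ b (cofactorTotal*b≤ 1≤b) ⟩
    D * divisorCount b * b         ≡⟨ trans (*-assoc D _ b) (cong (D *_) (*-comm _ b)) ⟩
    D * (b * divisorCount b)       ≤⟨ *-monoʳ-≤ D (≤-trans (m≤m+n _ 1) (divisorCount-spaced 1≤b)) ⟩
    D * (K + b)                    ∎
    where open ≤-Reasoning

  cofactorTotal≤30 : ∀ {b} → K < b → cofactorTotal b ≤ 30
  cofactorTotal≤30 {b} K<b = ≤-pred (*-cancelʳ-< b _ 31 (begin-strict
    cofactorTotal b * b     ≤⟨ cofactorTotal*b≤ 1≤b ⟩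
    D * divisorCount b      ≤⟨ *-monoʳ-≤ D (≤-pred divisorCount<2) ⟩
    D * 1                   ≡⟨ *-identityʳ D ⟩
    30 * K + 1              ≤⟨ +-monoˡ-≤ 1 (*-monoˡ-≤ K (n≤1+n 30)) ⟩
    31 * K + 1              <⟨ +-monoʳ-< (31 * K) (s≤s (s≤s z≤n)) ⟩
    31 * K + 31             ≡⟨ trans (+-comm (31 * K) 31) (sym (*-suc 31 K)) ⟩
    31 * suc K              ≤⟨ *-monoʳ-≤ 31 K<b ⟩
    31 * b                  ∎))
    where
    open ≤-Reasoning
    1≤b : 1 ≤ b
    1≤b = ≤-trans (s≤s z≤n) K<b
    divisorCount<2 : divisorCount b < 2
    divisorCount<2 = *-cancelˡ-< b _ 2 (begin-strict
      b * divisorCount b       <⟨ m<m+n _ z<s ⟩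
      b * divisorCount b + 1   ≤⟨ divisorCount-spaced 1≤b ⟩
      K + b                    <⟨ +-monoˡ-< b K<b ⟩
      b + b                    ≡⟨ cong (b +_) (+-identityʳ b) ⟨
      2 * b                    ≡⟨ *-comm 2 b ⟩
      b * 2                    ∎)

  small medium large : ℕ
  small = ∑ 994 (λ i → cofactorTotal (6 + i))
  medium = ∑ (K ∸ 1000) (λ i → cofactorTotal (1000 + i))
  large = ∑ (29 * K + 1) (λ i → cofactorTotal (K + i))

  ∑cofactorTotal-split : 1000 ≤ K → ∑ D cofactorTotal ≡ ∑ K 30n+1 + (small + medium + large)
  ∑cofactorTotal-split 1000≤K = begin
    ∑ D cofactorTotal                                  ≡⟨ cong (λ N → ∑ N cofactorTotal) (D≡ K) ⟩
    ∑ (K + (29 * K + 1)) cofactorTotal                 ≡⟨ ∑-split K (29 * K + 1) cofactorTotal ⟩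
    ∑ K cofactorTotal + large                          ≡⟨ cong (λ N → ∑ N cofactorTotal + large) (m+[n∸m]≡n 1000≤K) ⟨
    ∑ (1000 + (K ∸ 1000)) cofactorTotal + large        ≡⟨ cong (_+ large) (∑-split 1000 (K ∸ 1000) cofactorTotal) ⟩
    ∑ 1000 cofactorTotal + medium + large              ≡⟨ cong (λ s → s + medium + large) (∑-split 6 994 cofactorTotal) ⟩
    ∑ 6 cofactorTotal + small + medium + large         ≡⟨ cong (λ s → s + small + medium + large) ∑6≡ ⟩
    ∑ K 30n+1 + small + medium + large                 ≡⟨ regroup (∑ K 30n+1) small medium large ⟩
    ∑ K 30n+1 + (small + medium + large)               ∎
    where
    open ≡-Reasoning
    D≡ : ∀ K → 30 * K + 1 ≡ K + (29 * K + 1)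
    D≡ = solve-∀
    regroup : ∀ a s m l → a + s + m + l ≡ a + (s + m + l)
    regroup = solve-∀
    ∑6≡ : ∑ 6 cofactorTotal ≡ ∑ K 30n+1
    ∑6≡ = trans (∑-split 1 5 cofactorTotal) (trans (cong₂ _+_ cofactorTotal-1
            (∑-zeros 5 λ i 1≤i i≤5 → cofactorTotal-2…6 (s≤s 1≤i) (s≤s i≤5))) (+-identityʳ _))

  cofactorTotal-window : ∀ {b c} → 1 ≤ b → b ≤ c → cofactorTotal b * (b * pred b) ≤ D * (K + c)
  cofactorTotal-window {b} {c} 1≤b b≤c = begin
    cofactorTotal b * (b * pred b)  ≤⟨ *-monoʳ-≤ (cofactorTotal b) (*-monoʳ-≤ b pred[n]≤n) ⟩
    cofactorTotal b * (b * b)       ≤⟨ cofactorTotal*b²≤ 1≤b ⟩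
    D * (K + b)                     ≤⟨ *-monoʳ-≤ D (+-monoʳ-≤ K b≤c) ⟩
    D * (K + c)                     ∎
    where open ≤-Reasoning

  small-bound : 6 * small ≤ D * (K + 1000)
  small-bound = telescoping {6} 994 cofactorTotal {D * (K + 1000)} (s≤s z≤n) λ b 6<b b≤1000 →
    cofactorTotal-window (≤-trans (s≤s z≤n) 6<b) b≤1000

  medium-bound : 1000 ≤ K → 1000 * medium ≤ D * (K + K)
  medium-bound 1000≤K = telescoping {1000} (K ∸ 1000) cofactorTotal {D * (K + K)} (s≤s z≤n) λ b 1000<b b≤K →
    cofactorTotal-window (≤-trans (s≤s z≤n) 1000<b) (≤-trans b≤K (≤-reflexive (m+[n∸m]≡n 1000≤K)))

  large-bound : large ≤ (29 * K + 1) * 30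
  large-bound = ≤-trans (∑-mono-≤ (29 * K + 1) λ i 1≤i _ → cofactorTotal≤30 (m<m+n K 1≤i))
                        (≤-reflexive (∑-const (29 * K + 1) 30))

  excess-bound : 1000 ≤ K →
    6000 * (small + medium + large) ≤ 1000 * (D * (K + 1000)) + 6 * (D * (K + K)) + 6000 * ((29 * K + 1) * 30)
  excess-bound 1000≤K = begin
    6000 * (small + medium + large)                           ≡⟨ spread small medium large ⟩
    1000 * (6 * small) + 6 * (1000 * medium) + 6000 * large
      ≤⟨ +-mono-≤ (+-mono-≤ (*-monoʳ-≤ 1000 small-bound) (*-monoʳ-≤ 6 (medium-bound 1000≤K))) (*-monoʳ-≤ 6000 large-bound) ⟩
    1000 * (D * (K + 1000)) + 6 * (D * (K + K)) + 6000 * ((29 * K + 1) * 30) ∎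
    where
    open ≤-Reasoning
    spread : ∀ s m l → 6000 * (s + m + l) ≡ 1000 * (6 * s) + 6 * (1000 * m) + 6000 * l
    spread = solve-∀

  badSum : ℕ
  badSum = ∑ K (λ n → [ bad? n ]· n)

  -- The cofactor b = 1 accounts for 30n + 1 of σ(30n+1), so a bad n leaves at least 42n - 1 to b ≥ 2.
  42*badSum≤ : 1000 ≤ K → 42 * badSum ≤ K + (small + medium + large)
  42*badSum≤ 1000≤K = +-cancelˡ-≤ (∑ K (λ n → 30 * n)) _ _ (begin
    ∑ K (λ n → 30 * n) + 42 * badSum                       ≡⟨ cong (∑ K (λ n → 30 * n) +_) (*-distribˡ-∑ K 42 _) ⟩
    ∑ K (λ n → 30 * n) + ∑ K (λ n → 42 * [ bad? n ]· n)    ≡⟨ ∑-distrib-+ K _ _ ⟨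
    ∑ K (λ n → 30 * n + 42 * [ bad? n ]· n)                ≤⟨ ∑-mono-≤ K (λ n _ _ → pointwise n) ⟩
    ∑ K (λ n → σ (30n+1 n))                                ≡⟨ ∑σ≡∑cofactorTotal ⟩
    ∑ D cofactorTotal                                      ≡⟨ ∑cofactorTotal-split 1000≤K ⟩
    ∑ K 30n+1 + (small + medium + large)                   ≡⟨ cong (_+ (small + medium + large)) ∑30n+1 ⟩
    ∑ K (λ n → 30 * n) + K + (small + medium + large)      ≡⟨ +-assoc (∑ K (λ n → 30 * n)) K _ ⟩
    ∑ K (λ n → 30 * n) + (K + (small + medium + large))    ∎)
    where
    open ≤-Reasoning
    ∑30n+1 : ∑ K 30n+1 ≡ ∑ K (λ n → 30 * n) + K
    ∑30n+1 = trans (∑-distrib-+ K (λ n → 30 * n) (λ _ → 1)) (cong (∑ K (λ n → 30 * n) +_) (trans (∑-const K 1) (*-identityʳ K)))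
    pointwise : ∀ n → 30 * n + 42 * [ bad? n ]· n ≤ σ (30n+1 n)
    pointwise n with bad? n
    ... | yes 72n≤σ = ≤-trans (≤-reflexive (sym (*-distribʳ-+ n 30 42))) 72n≤σ
    ... | no _ = ≤-trans (≤-reflexive (+-identityʳ _)) (≤-trans (m≤m+n (30 * n) 1) (n≤σ[n] (30n+1 n)))

  bad-minority : 40000 ≤ K → 2 * count bad? K < K
  bad-minority 40000≤K with 2 * count bad? K <? K
  ... | yes minority = minority
  ... | no ¬minority = ⊥-elim (quadratic-contradiction {K} {badSum} {small + medium + large}
                                  40000≤K square (42*badSum≤ 1000≤K) (excess-bound 1000≤K))
    where
    open ≤-Reasoning
    1000≤K : 1000 ≤ K
    1000≤K = ≤-trans (m≤m+n 1000 39000) 40000≤K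
    B : ℕ
    B = count bad? K
    K≤2B : K ≤ 2 * B
    K≤2B = ≮⇒≥ ¬minority
    expand : ∀ B → 2 * B * (2 * B + 2) ≡ 4 * (B * suc B)
    expand = solve-∀
    square : K * (K + 2) ≤ 8 * badSum
    square = begin
      K * (K + 2)              ≤⟨ *-mono-≤ K≤2B (+-monoˡ-≤ 2 K≤2B) ⟩
      2 * B * (2 * B + 2)      ≡⟨ expand B ⟩
      4 * (B * suc B)          ≤⟨ *-monoʳ-≤ 4 (count-triangular bad? K) ⟩
      4 * (2 * badSum)         ≡⟨ *-assoc 4 2 badSum ⟨
      8 * badSum               ∎

countGreater<countLess : ∀ K → 2 * count bad? K < K → countGreater K < countLess K
countGreater<countLess K minority = begin-strict
  countGreater K    ≡⟨ length-filter-range1 greater? K ⟩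
  count greater? K  ≤⟨ count-mono greater? bad? (λ {n} gt → ≤-trans (σ[30n]≥72n n) (<⇒≤ gt)) K ⟩
  B                 <⟨ +-cancelʳ-< B B (count less? K) (<-≤-trans B+B<K (count-cover less? bad? (λ {n} → less {n}) K)) ⟩
  count less? K     ≡⟨ length-filter-range1 less? K ⟨
  countLess K       ∎
  where
  open ≤-Reasoning
  greater? : Decidable (λ n → σ (30 * n) < σ (30 * n + 1))
  greater? n = σ (30 * n) <? σ (30 * n + 1)
  less? : Decidable (λ n → σ (30 * n + 1) < σ (30 * n))
  less? n = σ (30 * n + 1) <? σ (30 * n)
  B : ℕ
  B = count bad? K
  B+B<K : B + B < K
  B+B<K = subst (_< K) (cong (B +_) (+-identityʳ B)) minority
  less : ∀ {n} → ¬ 72 * n ≤ σ (30n+1 n) → σ (30 * n + 1) < σ (30 * n)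
  less {n} ¬bad = <-≤-trans (≰⇒> ¬bad) (σ[30n]≥72n n)

theorem1 : Σ[ K₀ ∈ ℕ ] (1 ≤ K₀ × ((K : ℕ) → K₀ ≤ K → countGreater K < countLess K))
theorem1 = 40000 , s≤s z≤n , λ K 40000≤K → countGreater<countLess K (Progression.bad-minority K 40000≤K)
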